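{- For all $n\ge 10$, $\beta_n\ge\gamma_n$, where $\beta_{10}=\gamma_{10}=10$ and, for $n\ge 11$, $\beta_n=\beta_{n-1}\_n$ and $\gamma_n=n\_\gamma_{n-1}$.
   Context: For a positive integer $a$ with decimal expansion $a=\sum_{i=0}^{k} c_i 10^i$, $c_i\in\{0,\dots,9\}$, $c_k\neq 0$, and an integer $b\ge 10$, let $a\_b:=\sum_{i=0}^{k} c_i b^i$ (the decimal digit string of $a$ interpreted in base $b$). Thus $\beta_n=((\cdots((10\_11)\_12)\cdots)\_(n-1))\_n$ and $\gamma_n=n\_((n-1)\_(\cdots\_(12\_(11\_10))\cdots))$. -}

module Defs where

open import Data.Nat using (ℕ; zero; suc; _+_; _*_)
open import Data.Nat.DivMod using (_/_; _%_)
open import Data.List using (List; []; _∷_)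

-- Decimal digits of a, least significant first (empty list for a = 0).
-- The fuel argument bounds the recursion depth; fuel = a suffices
-- since a / 10 < a for a > 0.
digitsAux : ℕ → ℕ → List ℕ
digitsAux zero      a       = []
digitsAux (suc f)   zero    = []
digitsAux (suc f)   (suc a) = (suc a % 10) ∷ digitsAux f (suc a / 10)

digits : ℕ → List ℕ
digits a = digitsAux a a

evalBase : ℕ → List ℕ → ℕ
evalBase b []       = 0
evalBase b (c ∷ cs) = c + b * evalBase b cs

-- a _ b : the decimal digit string of a read in base b.
reinterp : ℕ → ℕ → ℕ
reinterp a b = evalBase b (digits a)

-- β 0 = β₁₀ = 10, β (suc k) = β_{11+k} = β_{10+k} _ (11+k)
β : ℕ → ℕ
β zero    = 10
β (suc k) = reinterp (β k) (11 + k)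

-- γ 0 = γ₁₀ = 10, γ (suc k) = γ_{11+k} = (11+k) _ γ_{10+k}
γ : ℕ → ℕ
γ zero    = 10
γ (suc k) = reinterp (11 + k) (γ k)

betaN : ℕ → ℕ
betaN n = β (n Data.Nat.∸ 10)

gammaN : ℕ → ℕ
gammaN n = γ (n Data.Nat.∸ 10)

{-# OPTIONS --safe #-}
-- From n = 27 on (index 17 of β and γ) the two sequences are separated by a
-- power-of-ten gap γ ≤ 10^m < 10^K ≤ β with K ≥ 25.  If the new index b has j + 1
-- digits, then reading b in base γ ≤ 10^m gives less than 10 · 10^(m j), while
-- reading β ≥ 10^K in base b ≥ 10^j gives at least b^K ≥ 10^(j K), or
-- b^K ≥ 11^K ≥ 10^(K + 1) when j = 1; so the gap persists.
-- The cases n < 27 are checked by evaluation.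
module Submission where

open import Defs
open import Data.Nat using (ℕ; zero; suc; _+_; _*_; _∸_; _^_; _≤_; _<_; _≥_; z≤n; s≤s; _≤?_; _<?_)
open import Data.Nat.Properties
open import Data.Nat.DivMod
open import Data.Fin using (Fin; toℕ; fromℕ<)
open import Data.Fin.Properties using (all?; toℕ-fromℕ<)
open import Data.List using ([]; _∷_)
open import Data.Product using (∃-syntax; _×_; _,_)
open import Relation.Binary.PropositionalEquality
open import Relation.Nullary using (yes; no; contradiction)
open import Relation.Nullary.Decidable using (toWitness)

[1+a]/10≤a : ∀ a → suc a / 10 ≤ a
[1+a]/10≤a a = ≤-pred (m/n<m (suc a) 10 (s≤s (s≤s z≤n)))

digitsAux-fuel : ∀ {f g} a → a ≤ f → a ≤ g → digitsAux f a ≡ digitsAux g a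
digitsAux-fuel {zero}  {zero}  _       _       _       = refl
digitsAux-fuel {zero}  {suc _} zero    _       _       = refl
digitsAux-fuel {suc _} {zero}  zero    _       _       = refl
digitsAux-fuel {suc _} {suc _} zero    _       _       = refl
digitsAux-fuel {suc f} {suc g} (suc a) (s≤s a≤f) (s≤s a≤g) =
  cong (suc a % 10 ∷_) (digitsAux-fuel (suc a / 10)
    (≤-trans ([1+a]/10≤a a) a≤f) (≤-trans ([1+a]/10≤a a) a≤g))

reinterp-%-/ : ∀ a b → reinterp a b ≡ a % 10 + b * reinterp (a / 10) b
reinterp-%-/ zero    b = sym (*-zeroʳ b)
reinterp-%-/ (suc a) b = cong (λ ds → suc a % 10 + b * evalBase b ds)
  (digitsAux-fuel (suc a / 10) ([1+a]/10≤a a) ≤-refl)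

evalBase-digitsAux : ∀ f a → a ≤ f → evalBase 10 (digitsAux f a) ≡ a
evalBase-digitsAux zero    zero    _         = refl
evalBase-digitsAux (suc f) zero    _         = refl
evalBase-digitsAux (suc f) (suc a) (s≤s a≤f) = begin
  suc a % 10 + 10 * evalBase 10 (digitsAux f (suc a / 10))
    ≡⟨ cong (λ q → suc a % 10 + 10 * q)
         (evalBase-digitsAux f (suc a / 10) (≤-trans ([1+a]/10≤a a) a≤f)) ⟩
  suc a % 10 + 10 * (suc a / 10)  ≡⟨ cong (suc a % 10 +_) (*-comm 10 (suc a / 10)) ⟩
  suc a % 10 + suc a / 10 * 10    ≡⟨ m≡m%n+[m/n]*n (suc a) 10 ⟨
  suc a                           ∎
  where open ≡-Reasoning

reinterp-10 : ∀ a → reinterp a 10 ≡ a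
reinterp-10 a = evalBase-digitsAux a a ≤-refl

evalBase-mono-≤ : ∀ {b b′} cs → b ≤ b′ → evalBase b cs ≤ evalBase b′ cs
evalBase-mono-≤ []       _    = ≤-refl
evalBase-mono-≤ (c ∷ cs) b≤b′ = +-monoʳ-≤ c (*-mono-≤ b≤b′ (evalBase-mono-≤ cs b≤b′))

reinterp-monoʳ-≤ : ∀ a {b b′} → b ≤ b′ → reinterp a b ≤ reinterp a b′
reinterp-monoʳ-≤ a = evalBase-mono-≤ (digits a)

a≤reinterp : ∀ a {b} → 10 ≤ b → a ≤ reinterp a b
a≤reinterp a {b} 10≤b = subst (_≤ reinterp a b) (reinterp-10 a) (reinterp-monoʳ-≤ a 10≤b)

reinterp-≤ : ∀ a b → reinterp a b ≤ 9 + b * reinterp (a / 10) b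
reinterp-≤ a b = subst (_≤ 9 + b * reinterp (a / 10) b) (sym (reinterp-%-/ a b))
  (+-monoˡ-≤ (b * reinterp (a / 10) b) (≤-pred (m%n<n a 10)))

b^K≤reinterp : ∀ K {a b} → 10 ≤ b → 10 ^ K ≤ a → b ^ K ≤ reinterp a b
b^K≤reinterp zero    {a} 10≤b 1≤a = ≤-trans 1≤a (a≤reinterp a 10≤b)
b^K≤reinterp (suc K) {a} {b} 10≤b 10^[1+K]≤a = begin
  b * b ^ K                 ≤⟨ *-monoʳ-≤ b (b^K≤reinterp K 10≤b 10^K≤a/10) ⟩
  b * reinterp (a / 10) b   ≤⟨ m≤n+m _ (a % 10) ⟩
  a % 10 + b * reinterp (a / 10) b  ≡⟨ reinterp-%-/ a b ⟨
  reinterp a b              ∎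
  where
  open ≤-Reasoning
  10^K≤a/10 : 10 ^ K ≤ a / 10
  10^K≤a/10 = subst (_≤ a / 10) (trans (cong (_/ 10) (*-comm 10 (10 ^ K))) (m*n/n≡m (10 ^ K) 10))
                (/-monoˡ-≤ 10 10^[1+K]≤a)

reinterp-< : ∀ j {a B} → 10 ≤ B → a < 10 ^ suc j → reinterp a B < 10 * B ^ j
reinterp-< zero {a} {B} _ a<10 = begin-strict
  reinterp a B                  ≤⟨ reinterp-≤ a B ⟩
  9 + B * reinterp (a / 10) B   ≡⟨ cong (λ q → 9 + B * reinterp q B) (m<n⇒m/n≡0 a<10′) ⟩
  9 + B * 0                     ≡⟨ cong (9 +_) (*-zeroʳ B) ⟩
  9                             <⟨ ≤-refl ⟩
  10 * 1                        ∎
  where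
  open ≤-Reasoning
  a<10′ : a < 10
  a<10′ = subst (a <_) (*-identityʳ 10) a<10
reinterp-< (suc j) {a} {B} 10≤B a<10^[2+j] = begin-strict
  reinterp a B      ≤⟨ reinterp-≤ a B ⟩
  9 + B * Q         <⟨ +-monoˡ-< (B * Q) 10≤B ⟩
  B + B * Q         ≡⟨ *-suc B Q ⟨
  B * suc Q         ≤⟨ *-monoʳ-≤ B (reinterp-< j 10≤B a/10<10^[1+j]) ⟩
  B * (10 * B ^ j)  ≡⟨ *-assoc B 10 (B ^ j) ⟨
  B * 10 * B ^ j    ≡⟨ cong (_* B ^ j) (*-comm B 10) ⟩
  10 * B * B ^ j    ≡⟨ *-assoc 10 B (B ^ j) ⟩
  10 * (B * B ^ j)  ∎
  where
  open ≤-Reasoning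
  Q = reinterp (a / 10) B
  a/10<10^[1+j] : a / 10 < 10 ^ suc j
  a/10<10^[1+j] = m<n*o⇒m/o<n (subst (a <_) (*-comm 10 (10 ^ suc j)) a<10^[2+j])

n<m^n : ∀ {m} n → 2 ≤ m → n < m ^ n
n<m^n zero    _   = s≤s z≤n
n<m^n {m} (suc n) 2≤m = begin
  suc (suc n)      ≤⟨ +-monoʳ-≤ 1 (m≤n+m (suc n) n) ⟩
  suc n + suc n    ≡⟨ cong (suc n +_) (+-identityʳ (suc n)) ⟨
  2 * suc n        ≤⟨ *-mono-≤ 2≤m (n<m^n n 2≤m) ⟩
  m * m ^ n        ∎
  where open ≤-Reasoning

decimal-magnitude : ∀ b → 1 ≤ b → ∃[ j ] 10 ^ j ≤ b × b < 10 ^ suc j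
decimal-magnitude b 1≤b = search b (n<m^n b (s≤s (s≤s z≤n)))
  where
  search : ∀ t → b < 10 ^ t → ∃[ j ] 10 ^ j ≤ b × b < 10 ^ suc j
  search zero    b<1 = contradiction (≤-trans (s≤s 1≤b) b<1) (<-irrefl refl)
  search (suc t) b<10^[1+t] with 10 ^ t ≤? b
  ... | yes 10^t≤b = t , 10^t≤b , b<10^[1+t]
  ... | no  10^t≰b = search t (≰⇒> 10^t≰b)

-- 25 is the least exponent with (11/10)^n ≥ 10.
10^[1+n]≤11^n : ∀ n → 25 ≤ n → 10 ^ suc n ≤ 11 ^ n
10^[1+n]≤11^n n 25≤n = subst (λ k → 10 ^ suc k ≤ 11 ^ k) (m∸n+n≡m 25≤n) (from25 (n ∸ 25))
  where
  from25 : ∀ i → 10 ^ suc (i + 25) ≤ 11 ^ (i + 25)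
  from25 zero    = toWitness {a? = 10 ^ 26 ≤? 11 ^ 25} _
  from25 (suc i) = ≤-trans (*-monoʳ-≤ 10 (from25 i)) (*-monoˡ-≤ (11 ^ (i + 25)) (n≤1+n 10))

record PowerGap (x g : ℕ) : Set where
  constructor gap
  field
    m K    : ℕ
    1≤m    : 1 ≤ m
    m<K    : m < K
    25≤K   : 25 ≤ K
    g≤10^m : g ≤ 10 ^ m
    10^K≤x : 10 ^ K ≤ x

PowerGap⇒≤ : ∀ {x g} → PowerGap x g → g ≤ x
PowerGap⇒≤ (gap m K _ m<K _ g≤10^m 10^K≤x) =
  ≤-trans g≤10^m (≤-trans (^-monoʳ-≤ 10 (<⇒≤ m<K)) 10^K≤x)

1+m*j<j*K : ∀ {m K} j → 2 ≤ j → m < K → suc (m * j) < j * K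
1+m*j<j*K {m} {K} j 2≤j m<K = begin-strict
  suc (m * j)  <⟨ +-monoˡ-< (m * j) 2≤j ⟩
  j + m * j    ≡⟨ cong (j +_) (*-comm m j) ⟩
  j + j * m    ≡⟨ *-suc j m ⟨
  j * suc m    ≤⟨ *-monoʳ-≤ j m<K ⟩
  j * K        ∎
  where open ≤-Reasoning

reinterp-≤-10^ : ∀ {a g m} j → 1 ≤ m → g ≤ 10 ^ m → a < 10 ^ suc j →
                 reinterp a g ≤ 10 ^ suc (m * j)
reinterp-≤-10^ {a} {g} {m} j 1≤m g≤10^m a<10^[1+j] = <⇒≤ (begin-strict
  reinterp a g         ≤⟨ reinterp-monoʳ-≤ a g≤10^m ⟩
  reinterp a (10 ^ m)  <⟨ reinterp-< j (^-monoʳ-≤ 10 1≤m) a<10^[1+j] ⟩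
  10 * (10 ^ m) ^ j    ≡⟨ cong (10 *_) (^-*-assoc 10 m j) ⟩
  10 ^ suc (m * j)     ∎)
  where open ≤-Reasoning

PowerGap-step : ∀ {x g b} → 11 ≤ b → PowerGap x g → PowerGap (reinterp x b) (reinterp b g)
PowerGap-step {x} {g} {b} 11≤b (gap m K 1≤m m<K 25≤K g≤10^m 10^K≤x)
  with decimal-magnitude b (≤-trans (s≤s z≤n) 11≤b)
... | zero , _ , b<10 = contradiction (≤-trans (n≤1+n 10) 11≤b) (<⇒≱ b<10)
... | suc zero , _ , b<100 =
  gap (suc (m * 1)) (suc K) (s≤s z≤n) (s≤s (subst (_< K) (sym (*-identityʳ m)) m<K))
    (≤-trans 25≤K (n≤1+n K)) (reinterp-≤-10^ 1 1≤m g≤10^m b<100)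
    (≤-trans (10^[1+n]≤11^n K 25≤K)
      (≤-trans (^-monoˡ-≤ K 11≤b) (b^K≤reinterp K (≤-trans (n≤1+n 10) 11≤b) 10^K≤x)))
... | j@(suc (suc _)) , 10^j≤b , b<10^[1+j] =
  gap (suc (m * j)) (j * K) (s≤s z≤n) (1+m*j<j*K j (s≤s (s≤s z≤n)) m<K)
    (≤-trans 25≤K (m≤n*m K j)) (reinterp-≤-10^ j 1≤m g≤10^m b<10^[1+j])
    (subst (_≤ reinterp x b) (^-*-assoc 10 j K)
      (≤-trans (^-monoˡ-≤ K 10^j≤b) (b^K≤reinterp K (≤-trans (n≤1+n 10) 11≤b) 10^K≤x)))

γ≤β-below-17 : ∀ (k : Fin 17) → γ (toℕ k) ≤ β (toℕ k)
γ≤β-below-17 = toWitness {a? = all? (λ k → γ (toℕ k) ≤? β (toℕ k))} _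

PowerGap-from-17 : ∀ i → PowerGap (β (17 + i)) (γ (17 + i))
PowerGap-from-17 zero    = gap 5 26 (s≤s z≤n) (toWitness {a? = 5 <? 26} _) (toWitness {a? = 25 ≤? 26} _)
  (toWitness {a? = γ 17 ≤? 10 ^ 5} _) (toWitness {a? = 10 ^ 26 ≤? β 17} _)
PowerGap-from-17 (suc i) = PowerGap-step (m≤m+n 11 (17 + i)) (PowerGap-from-17 i)

γ≤β : ∀ k → γ k ≤ β k
γ≤β k with k <? 17
... | yes k<17 = subst (λ i → γ i ≤ β i) (toℕ-fromℕ< k<17) (γ≤β-below-17 (fromℕ< k<17))
... | no  k≮17 = subst (λ i → γ i ≤ β i) (m+[n∸m]≡n (≮⇒≥ k≮17)) (PowerGap⇒≤ (PowerGap-from-17 (k ∸ 17)))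

theorem3 : (n : ℕ) → n ≥ 10 → betaN n ≥ gammaN n
theorem3 n _ = γ≤β (n ∸ 10)
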